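{- Let $\mathcal{Q}$ and $\mathcal{Q}'$ be seminormal quasi-crystals of the same type with underlying sets $Q,Q'$, and let $\psi:Q\to Q'$ be a map. Then $\psi$ (extended by $\psi(\bot)=\bot$) is a quasi-crystal isomorphism between $\mathcal{Q}$ and $\mathcal{Q}'$ if and only if $\psi$ is an isomorphism between the weighted labelled directed graphs $\Gamma_{\mathcal{Q}}$ and $\Gamma_{\mathcal{Q}'}$.
   Context: Root system data: $V$ a finite-dimensional real inner product space, $\alpha^\vee=\frac{2}{\langle\alpha,\alpha\rangle}\alpha$; a root system $\Phi$ with fixed simple roots $(\alpha_i)_{i\in I}$ and weight lattice $\Lambda$ (a $\mathbb{Z}$-submodule of $V$ spanning $V$, containing $\Phi$, with $\langle\lambda,\alpha^\vee\rangle\in\mathbb{Z}$ for $\alpha\in\Phi$). A quasi-crystal of type $\Phi$ is a set $Q$ with maps $\mathrm{wt}:Q\to\Lambda$, $\ddot{e}_i,\ddot{f}_i:Q\to Q\sqcup\{\bot\}$ ($\bot$ = undefined), $\ddot{\varepsilon}_i,\ddot{\varphi}_i:Q\to\mathbb{Z}\cup\{\pm\infty\}$ ($i\in I$) such that for all $x,y$: $\ddot{\varphi}_i(x)=\ddot{\varepsilon}_i(x)+\langle\mathrm{wt}(x),\alpha_i^\vee\rangle$ (with $m+(\pm\infty)=\pm\infty$); if $\ddot{e}_i(x)\in Q$ then $\mathrm{wt}(\ddot{e}_i(x))=\mathrm{wt}(x)+\alpha_i$, $\ddot{\varepsilon}_i(\ddot{e}_i(x))=\ddot{\varepsilon}_i(x)-1$,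 $\ddot{\varphi}_i(\ddot{e}_i(x))=\ddot{\varphi}_i(x)+1$; if $\ddot{f}_i(x)\in Q$ then $\mathrm{wt}(\ddot{f}_i(x))=\mathrm{wt}(x)-\alpha_i$, $\ddot{\varepsilon}_i(\ddot{f}_i(x))=\ddot{\varepsilon}_i(x)+1$, $\ddot{\varphi}_i(\ddot{f}_i(x))=\ddot{\varphi}_i(x)-1$; $\ddot{e}_i(x)=y\iff x=\ddot{f}_i(y)$; $\ddot{\varepsilon}_i(x)=\pm\infty$ implies $\ddot{e}_i(x)=\ddot{f}_i(x)=\bot$. It is seminormal if whenever $\ddot{\varepsilon}_i(x)\ne+\infty$, $\ddot{\varepsilon}_i(x)=\max\{k\ge0:\ddot{e}_i^k(x)\in Q\}$ and $\ddot{\varphi}_i(x)=\max\{k\ge0:\ddot{f}_i^k(x)\in Q\}$. A quasi-crystal homomorphism $\psi:\mathcal{Q}\to\mathcal{Q}'$ is a map $Q\sqcup\{\bot\}\to Q'\sqcup\{\bot\}$ with $\psi(\bot)=\bot$ such that whenever $\psi(x)\in Q'$ it has the same $\mathrm{wt},\ddot{\varepsilon}_i,\ddot{\varphi}_i$ as $x$, and $\psi(\ddot{e}_i(x))=\ddot{e}_i(\psi(x))$ (resp. $\psi(\ddot{f}_i(x))=\ddot{f}_i(\psi(x))$) whenever $\ddot{e}_i(x)\in Q$ (resp. $\ddot{f}_i(x)\in Q$) and $\psi(x)$ and $\psi(\ddot{e}_i(x))$ (resp. $\psi(\ddot{f}_i(x))$) lie in $Q'$. A quasi-crystal isomorphism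 is a bijection $\psi$ with $\psi,\psi^{ -1}$ homomorphisms. The quasi-crystal graph $\Gamma_{\mathcal{Q}}$ is the $\Lambda$-weighted (vertex $x$ has weight $\mathrm{wt}(x)$) $I$-labelled directed graph with vertex set $Q$, an edge $x\xrightarrow{i}y$ whenever $\ddot{f}_i(x)=y$, and a loop at $x$ labelled $i$ whenever $\ddot{\varepsilon}_i(x)=+\infty$. A homomorphism of such graphs is a weight-preserving map of vertices sending each edge $x\xrightarrow{i}y$ to an edge $\psi(x)\xrightarrow{i}\psi(y)$; an isomorphism is a bijective homomorphism whose inverse is a homomorphism. -}

module Defs where

open import Data.Nat using (ℕ; zero; suc; _≤_)
open import Data.Integer as ℤ using (ℤ; +_)
open import Data.Maybe using (Maybe; just; nothing; _>>=_)
open import Data.Product using (Σ; ∃; _×_; _,_)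
open import Data.Sum using (_⊎_)
open import Relation.Binary.PropositionalEquality using (_≡_)
open import Relation.Nullary using (¬_)
open import Algebra.Structures using (IsAbelianGroup)

-- The theorem only uses: the index set I of simple
-- roots, the weight lattice Λ (an abelian group), the simple roots
-- α i ∈ Λ, and the integer pairings ⟨λ , α_i^∨⟩ (additive in λ, with
-- ⟨α_i , α_i^∨⟩ = 2).

record RootDatum : Set₁ where
  field
    I       : Set
    Λ       : Set
    _+Λ_    : Λ → Λ → Λ
    0Λ      : Λ
    -Λ_     : Λ → Λ
    isAbelianGroup : IsAbelianGroup _≡_ _+Λ_ 0Λ -Λ_
    α       : I → Λ
    ⟨_,_∨⟩  : Λ → I → ℤ
    pairing-+ : ∀ l m i → ⟨ l +Λ m , i ∨⟩ ≡ ⟨ l , i ∨⟩ ℤ.+ ⟨ m , i ∨⟩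
    pairing-α : ∀ i → ⟨ α i , i ∨⟩ ≡ + 2

  _-Λ_ : Λ → Λ → Λ
  x -Λ y = x +Λ (-Λ y)

data ℤ∞ : Set where
  -∞  : ℤ∞
  fin : ℤ → ℤ∞
  +∞  : ℤ∞

_⊕_ : ℤ∞ → ℤ → ℤ∞
-∞    ⊕ n = -∞
fin m ⊕ n = fin (m ℤ.+ n)
+∞    ⊕ n = +∞

sucℤ∞ predℤ∞ : ℤ∞ → ℤ∞
sucℤ∞ x = x ⊕ (+ 1)
predℤ∞ x = x ⊕ (ℤ.- (+ 1))

-- Iterating a partial map;  iter k g x = g^k(x)  (nothing = ⊥)

iter : {A : Set} → ℕ → (A → Maybe A) → A → Maybe A
iter zero    g x = just x
iter (suc k) g x = iter k g x >>= g

Defined : {A : Set} → Maybe A → Set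
Defined m = ∃ λ a → m ≡ just a

module _ (R : RootDatum) where
  open RootDatum R

  record QuasiCrystal : Set₁ where
    field
      Q   : Set
      wt  : Q → Λ
      ë f̈ : I → Q → Maybe Q
      ε̈ φ̈ : I → Q → ℤ∞
      φ̈-def  : ∀ i x → φ̈ i x ≡ ε̈ i x ⊕ ⟨ wt x , i ∨⟩
      ë-wt   : ∀ i x y → ë i x ≡ just y → wt y ≡ wt x +Λ α i
      ë-ε̈    : ∀ i x y → ë i x ≡ just y → ε̈ i y ≡ predℤ∞ (ε̈ i x)
      ë-φ̈    : ∀ i x y → ë i x ≡ just y → φ̈ i y ≡ sucℤ∞ (φ̈ i x)
      f̈-wt   : ∀ i x y → f̈ i x ≡ just y → wt y ≡ wt x -Λ α i
      f̈-ε̈    : ∀ i x y → f̈ i x ≡ just y → ε̈ i y ≡ sucℤ∞ (ε̈ i x)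
      f̈-φ̈    : ∀ i x y → f̈ i x ≡ just y → φ̈ i y ≡ predℤ∞ (φ̈ i x)
      ë⇒f̈    : ∀ i x y → ë i x ≡ just y → f̈ i y ≡ just x
      f̈⇒ë    : ∀ i x y → f̈ i y ≡ just x → ë i x ≡ just y
      +∞⇒ë⊥  : ∀ i x → ε̈ i x ≡ +∞ → ë i x ≡ nothing × f̈ i x ≡ nothing
      -∞⇒ë⊥  : ∀ i x → ε̈ i x ≡ -∞ → ë i x ≡ nothing × f̈ i x ≡ nothing

  IsMaxIter : {A : Set} → ℤ∞ → (A → Maybe A) → A → Set
  IsMaxIter v g x =
    Σ ℕ λ k → (v ≡ fin (+ k)) × Defined (iter k g x)
              × (∀ m → Defined (iter m g x) → m ≤ k)

  record IsSeminormal (𝒬 : QuasiCrystal) : Set where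
    open QuasiCrystal 𝒬
    field
      seminormal : ∀ i x → ¬ (ε̈ i x ≡ +∞) →
                   IsMaxIter (ε̈ i x) (ë i) x × IsMaxIter (φ̈ i x) (f̈ i) x

  record IsQCHom (𝒬 𝒬' : QuasiCrystal)
         (ψ : Maybe (QuasiCrystal.Q 𝒬) → Maybe (QuasiCrystal.Q 𝒬')) : Set where
    module A = QuasiCrystal 𝒬
    module B = QuasiCrystal 𝒬'
    field
      ψ-⊥   : ψ nothing ≡ nothing
      ψ-wt  : ∀ x y → ψ (just x) ≡ just y → B.wt y ≡ A.wt x
      ψ-ε̈   : ∀ i x y → ψ (just x) ≡ just y → B.ε̈ i y ≡ A.ε̈ i x
      ψ-φ̈   : ∀ i x y → ψ (just x) ≡ just y → B.φ̈ i y ≡ A.φ̈ i x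
      ψ-ë   : ∀ i x x' y y' → A.ë i x ≡ just x' → ψ (just x) ≡ just y →
              ψ (just x') ≡ just y' → B.ë i y ≡ just y'
      ψ-f̈   : ∀ i x x' y y' → A.f̈ i x ≡ just x' → ψ (just x) ≡ just y →
              ψ (just x') ≡ just y' → B.f̈ i y ≡ just y'

  IsQCIso : (𝒬 𝒬' : QuasiCrystal) →
            (Maybe (QuasiCrystal.Q 𝒬) → Maybe (QuasiCrystal.Q 𝒬')) → Set
  IsQCIso 𝒬 𝒬' ψ =
    Σ (Maybe (QuasiCrystal.Q 𝒬') → Maybe (QuasiCrystal.Q 𝒬)) λ χ →
      (∀ x → χ (ψ x) ≡ x) × (∀ y → ψ (χ y) ≡ y)
      × IsQCHom 𝒬 𝒬' ψ × IsQCHom 𝒬' 𝒬 χ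

  record LabelledGraph : Set₁ where
    field
      Vert   : Set
      weight : Vert → Λ
      Edge   : I → Vert → Vert → Set

  record IsGraphHom (G H : LabelledGraph)
         (ψ : LabelledGraph.Vert G → LabelledGraph.Vert H) : Set where
    module G = LabelledGraph G
    module H = LabelledGraph H
    field
      hom-weight : ∀ x → H.weight (ψ x) ≡ G.weight x
      hom-edge   : ∀ i x y → G.Edge i x y → H.Edge i (ψ x) (ψ y)

  IsGraphIso : (G H : LabelledGraph) →
               (LabelledGraph.Vert G → LabelledGraph.Vert H) → Set
  IsGraphIso G H ψ =
    Σ (LabelledGraph.Vert H → LabelledGraph.Vert G) λ χ →
      (∀ x → χ (ψ x) ≡ x) × (∀ y → ψ (χ y) ≡ y)
      × IsGraphHom G H ψ × IsGraphHom H G χ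

  Γ : QuasiCrystal → LabelledGraph
  Γ 𝒬 = record
    { Vert   = Q
    ; weight = wt
    ; Edge   = λ i x y → (f̈ i x ≡ just y) ⊎ ((ε̈ i x ≡ +∞) × (x ≡ y))
    }
    where open QuasiCrystal 𝒬

-- A graph isomorphism already fixes weights and the ë/f̈ arrows (an f̈-edge can
-- never be mistaken for a loop, since f̈ changes ε̈ by one and is undefined where
-- ε̈ = +∞). Loops record exactly where ε̈ = +∞; elsewhere seminormality reads ε̈
-- off the graph as the length of the ë-string through a vertex, which the
-- isomorphism preserves in both directions, and φ̈ then follows from φ̈ = ε̈ + ⟨wt, α∨⟩.
-- Conversely a quasi-crystal isomorphism of the form map ψ restricts to a graph
-- isomorphism, because its inverse cannot send a vertex to ⊥.
module Submission where

open import Defs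
open import Data.Maybe using (Maybe; map; just; nothing)
open import Data.Maybe.Properties using (just-injective)
open import Data.Product using (∃; _×_; _,_; proj₁; proj₂)
open import Data.Sum using (inj₁; inj₂)
open import Data.Nat using (zero; suc)
open import Data.Nat.Properties using (≤-antisym)
open import Data.Integer as ℤ using (+_)
open import Data.Integer.Properties using (i≢suc[i]; +-comm)
open import Relation.Nullary using (Dec; yes; no; contradiction)
open import Relation.Binary.PropositionalEquality

fin-injective : ∀ {m n} → fin m ≡ fin n → m ≡ n
fin-injective refl = refl

_≟+∞ : (z : ℤ∞) → Dec (z ≡ +∞)
-∞    ≟+∞ = no λ ()
fin _ ≟+∞ = no λ ()
+∞    ≟+∞ = yes refl

map-inverseˡ : {A B : Set} {f : A → B} {g : B → A} →
               (∀ x → g (f x) ≡ x) → ∀ m → map g (map f m) ≡ m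
map-inverseˡ g∘f≗id (just x) = cong just (g∘f≗id x)
map-inverseˡ g∘f≗id nothing  = refl

module MapSection {A B : Set} {f : A → B} {χ : Maybe B → Maybe A}
                  (map-f∘χ≗id : ∀ m → map f (χ m) ≡ m) where

  χ-just : ∀ y → ∃ λ x → χ (just y) ≡ just x
  χ-just y with χ (just y) | map-f∘χ≗id (just y)
  ... | just x | _ = x , refl

  χ-restriction : B → A
  χ-restriction y = proj₁ (χ-just y)

  χ-restriction-just : ∀ y → χ (just y) ≡ just (χ-restriction y)
  χ-restriction-just y = proj₂ (χ-just y)

module _ {A B : Set} {g : A → Maybe A} {h : B → Maybe B} {ψ : A → B}
         (commute : ∀ {x y} → g x ≡ just y → h (ψ x) ≡ just (ψ y)) where

  iter-commute : ∀ k {x z} → iter k g x ≡ just z → iter k h (ψ x) ≡ just (ψ z)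
  iter-commute zero    refl = refl
  iter-commute (suc k) {x} p with iter k g x in eq
  ... | just w rewrite iter-commute k eq = commute p

  Defined-iter-commute : ∀ k {x} → Defined (iter k g x) → Defined (iter k h (ψ x))
  Defined-iter-commute k (z , p) = ψ z , iter-commute k p

module _ (R : RootDatum) where

  IsMaxIter-unique : {A B : Set} {g : A → Maybe A} {h : B → Maybe B} {x : A} {y : B}
    {v w : ℤ∞} →
    (∀ k → Defined (iter k g x) → Defined (iter k h y)) →
    (∀ k → Defined (iter k h y) → Defined (iter k g x)) →
    IsMaxIter R v g x → IsMaxIter R w h y → v ≡ w
  IsMaxIter-unique g⇒h h⇒g (k , refl , gᵏ , g-max) (l , refl , hˡ , h-max) =
    cong (λ n → fin (+ n)) (≤-antisym (h-max k (g⇒h k gᵏ)) (g-max l (h⇒g l hˡ)))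

  module _ (𝒬 : QuasiCrystal R) where
    open QuasiCrystal 𝒬

    f̈-irreflexive : ∀ i x → f̈ i x ≢ just x
    f̈-irreflexive i x f̈x≡x with ε̈ i x in eq
    ... | -∞    with () ← trans (sym f̈x≡x) (proj₂ (-∞⇒ë⊥ i x eq))
    ... | +∞    with () ← trans (sym f̈x≡x) (proj₂ (+∞⇒ë⊥ i x eq))
    ... | fin m = i≢suc[i] (trans m≡m+1 (+-comm m (+ 1)))
      where
        m≡m+1 : m ≡ m ℤ.+ + 1
        m≡m+1 = fin-injective (trans (sym eq) (trans (f̈-ε̈ i x x f̈x≡x) (cong sucℤ∞ eq)))

  module _ {𝒬 𝒬' : QuasiCrystal R} {ψ : QuasiCrystal.Q 𝒬 → QuasiCrystal.Q 𝒬'}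
           (hψ : IsGraphHom R (Γ R 𝒬) (Γ R 𝒬') ψ) where
    open QuasiCrystal 𝒬
    private module 𝒬' = QuasiCrystal 𝒬'
    open IsGraphHom hψ

    +∞-preserved : ∀ i x → ε̈ i x ≡ +∞ → 𝒬'.ε̈ i (ψ x) ≡ +∞
    +∞-preserved i x ε̈x≡+∞ with hom-edge i x x (inj₂ (ε̈x≡+∞ , refl))
    ... | inj₁ f̈ψx≡ψx       = contradiction f̈ψx≡ψx (f̈-irreflexive 𝒬' i (ψ x))
    ... | inj₂ (ε̈'ψx≡+∞ , _) = ε̈'ψx≡+∞

  module GraphIso {𝒬 𝒬' : QuasiCrystal R}
                  {ψ : QuasiCrystal.Q 𝒬 → QuasiCrystal.Q 𝒬'}
                  {χ : QuasiCrystal.Q 𝒬' → QuasiCrystal.Q 𝒬}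
                  (χ∘ψ≗id : ∀ x → χ (ψ x) ≡ x)
                  (hψ : IsGraphHom R (Γ R 𝒬) (Γ R 𝒬') ψ)
                  (hχ : IsGraphHom R (Γ R 𝒬') (Γ R 𝒬) χ) where
    open QuasiCrystal 𝒬
    private module 𝒬' = QuasiCrystal 𝒬'
    open IsGraphHom hψ

    +∞-reflected : ∀ i x → 𝒬'.ε̈ i (ψ x) ≡ +∞ → ε̈ i x ≡ +∞
    +∞-reflected i x ε̈'ψx≡+∞ =
      subst (λ z → ε̈ i z ≡ +∞) (χ∘ψ≗id x) (+∞-preserved {𝒬'} {𝒬} hχ i (ψ x) ε̈'ψx≡+∞)

    f̈-preserved : ∀ i {x y} → f̈ i x ≡ just y → 𝒬'.f̈ i (ψ x) ≡ just (ψ y)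
    f̈-preserved i {x} {y} f̈x≡y with hom-edge i x y (inj₁ f̈x≡y)
    ... | inj₁ f̈ψx≡ψy       = f̈ψx≡ψy
    ... | inj₂ (ε̈'ψx≡+∞ , _)
      with () ← trans (sym f̈x≡y) (proj₂ (+∞⇒ë⊥ i x (+∞-reflected i x ε̈'ψx≡+∞)))

    ë-preserved : ∀ i {x y} → ë i x ≡ just y → 𝒬'.ë i (ψ x) ≡ just (ψ y)
    ë-preserved i {x} {y} ëx≡y = 𝒬'.f̈⇒ë i (ψ x) (ψ y) (f̈-preserved i (ë⇒f̈ i x y ëx≡y))

  module _ {𝒬 𝒬' : QuasiCrystal R} (s : IsSeminormal R 𝒬) (s' : IsSeminormal R 𝒬')
           {ψ : QuasiCrystal.Q 𝒬 → QuasiCrystal.Q 𝒬'}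
           {χ : QuasiCrystal.Q 𝒬' → QuasiCrystal.Q 𝒬}
           (χ∘ψ≗id : ∀ x → χ (ψ x) ≡ x) (ψ∘χ≗id : ∀ y → ψ (χ y) ≡ y)
           (hψ : IsGraphHom R (Γ R 𝒬) (Γ R 𝒬') ψ)
           (hχ : IsGraphHom R (Γ R 𝒬') (Γ R 𝒬) χ) where
    open QuasiCrystal 𝒬
    private
      module 𝒬' = QuasiCrystal 𝒬'
      module ψ = GraphIso {𝒬} {𝒬'} χ∘ψ≗id hψ hχ
      module χ = GraphIso {𝒬'} {𝒬} ψ∘χ≗id hχ hψ
    open IsGraphHom hψ
    open IsSeminormal

    ε̈-preserved : ∀ i x → 𝒬'.ε̈ i (ψ x) ≡ ε̈ i x
    ε̈-preserved i x with ε̈ i x ≟+∞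
    ... | yes ε̈x≡+∞ = trans (+∞-preserved {𝒬} {𝒬'} hψ i x ε̈x≡+∞) (sym ε̈x≡+∞)
    ... | no  ε̈x≢+∞ =
      IsMaxIter-unique ψ⇐ ψ⇒
        (proj₁ (seminormal s' i (ψ x) (λ ε̈'ψx≡+∞ → ε̈x≢+∞ (ψ.+∞-reflected i x ε̈'ψx≡+∞))))
        (proj₁ (seminormal s i x ε̈x≢+∞))
      where
        ψ⇒ : ∀ k → Defined (iter k (ë i) x) → Defined (iter k (𝒬'.ë i) (ψ x))
        ψ⇒ k = Defined-iter-commute (ψ.ë-preserved i) k
        ψ⇐ : ∀ k → Defined (iter k (𝒬'.ë i) (ψ x)) → Defined (iter k (ë i) x)
        ψ⇐ k d = subst (λ z → Defined (iter k (ë i) z)) (χ∘ψ≗id x)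
                       (Defined-iter-commute (χ.ë-preserved i) k d)

    φ̈-preserved : ∀ i x → 𝒬'.φ̈ i (ψ x) ≡ φ̈ i x
    φ̈-preserved i x = begin
      𝒬'.φ̈ i (ψ x)                                     ≡⟨ 𝒬'.φ̈-def i (ψ x) ⟩
      𝒬'.ε̈ i (ψ x) ⊕ ⟨ 𝒬'.wt (ψ x) , i ∨⟩                ≡⟨ cong₂ (λ e l → e ⊕ ⟨ l , i ∨⟩)
                                                            (ε̈-preserved i x) (hom-weight x) ⟩
      ε̈ i x ⊕ ⟨ wt x , i ∨⟩                              ≡⟨ sym (φ̈-def i x) ⟩
      φ̈ i x                                            ∎
      where
        open ≡-Reasoning
        open RootDatum R using (⟨_,_∨⟩)

    graphIso⇒qcHom : IsQCHom R 𝒬 𝒬' (map ψ)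
    graphIso⇒qcHom = record
      { ψ-⊥  = refl
      ; ψ-wt = λ { x _ refl → hom-weight x }
      ; ψ-ε̈  = λ { i x _ refl → ε̈-preserved i x }
      ; ψ-φ̈  = λ { i x _ refl → φ̈-preserved i x }
      ; ψ-ë  = λ { i x x' _ _ ëx≡x' refl refl → ψ.ë-preserved i ëx≡x' }
      ; ψ-f̈  = λ { i x x' _ _ f̈x≡x' refl refl → ψ.f̈-preserved i f̈x≡x' }
      }

  qcHom⇒graphHom : {𝒬 𝒬' : QuasiCrystal R}
    {φ : Maybe (QuasiCrystal.Q 𝒬) → Maybe (QuasiCrystal.Q 𝒬')}
    {ψ : QuasiCrystal.Q 𝒬 → QuasiCrystal.Q 𝒬'} →
    (∀ x → φ (just x) ≡ just (ψ x)) →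
    IsQCHom R 𝒬 𝒬' φ → IsGraphHom R (Γ R 𝒬) (Γ R 𝒬') ψ
  qcHom⇒graphHom {ψ = ψ} φ≡ψ hφ = record
    { hom-weight = λ x → ψ-wt x (ψ x) (φ≡ψ x)
    ; hom-edge   = λ
      { i x y (inj₁ f̈x≡y) → inj₁ (ψ-f̈ i x y (ψ x) (ψ y) f̈x≡y (φ≡ψ x) (φ≡ψ y))
      ; i x _ (inj₂ (ε̈x≡+∞ , refl)) → inj₂ (trans (ψ-ε̈ i x (ψ x) (φ≡ψ x)) ε̈x≡+∞ , refl)
      }
    }
    where open IsQCHom hφ

  qcIso⇒graphIso : {𝒬 𝒬' : QuasiCrystal R} {ψ : QuasiCrystal.Q 𝒬 → QuasiCrystal.Q 𝒬'} →
    IsQCIso R 𝒬 𝒬' (map ψ) → IsGraphIso R (Γ R 𝒬) (Γ R 𝒬') ψ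
  qcIso⇒graphIso {ψ = ψ} (χ , χ∘ψ≗id , ψ∘χ≗id , hψ , hχ) =
      χ-restriction
    , (λ x → just-injective (trans (sym (χ-restriction-just (ψ x))) (χ∘ψ≗id (just x))))
    , (λ y → just-injective (trans (cong (map ψ) (sym (χ-restriction-just y)))
                                   (ψ∘χ≗id (just y))))
    , qcHom⇒graphHom (λ _ → refl) hψ
    , qcHom⇒graphHom χ-restriction-just hχ
    where open MapSection {f = ψ} {χ = χ} ψ∘χ≗id

  graphIso⇒qcIso : {𝒬 𝒬' : QuasiCrystal R} → IsSeminormal R 𝒬 → IsSeminormal R 𝒬' →
    {ψ : QuasiCrystal.Q 𝒬 → QuasiCrystal.Q 𝒬'} →
    IsGraphIso R (Γ R 𝒬) (Γ R 𝒬') ψ → IsQCIso R 𝒬 𝒬' (map ψ)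
  graphIso⇒qcIso s s' (χ , χ∘ψ≗id , ψ∘χ≗id , hψ , hχ) =
      map χ , map-inverseˡ χ∘ψ≗id , map-inverseˡ ψ∘χ≗id
    , graphIso⇒qcHom s s' χ∘ψ≗id ψ∘χ≗id hψ hχ
    , graphIso⇒qcHom s' s ψ∘χ≗id χ∘ψ≗id hχ hψ

theorem4p13 : (R : RootDatum) (𝒬 𝒬' : QuasiCrystal R) →
    IsSeminormal R 𝒬 → IsSeminormal R 𝒬' →
    (ψ : QuasiCrystal.Q 𝒬 → QuasiCrystal.Q 𝒬') →
    (IsQCIso R 𝒬 𝒬' (map ψ) → IsGraphIso R (Γ R 𝒬) (Γ R 𝒬') ψ)
    × (IsGraphIso R (Γ R 𝒬) (Γ R 𝒬') ψ → IsQCIso R 𝒬 𝒬' (map ψ))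
theorem4p13 R 𝒬 𝒬' s s' ψ = qcIso⇒graphIso R , graphIso⇒qcIso R s s'
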